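{- Let $U$ be a clopen subset of a descriptive $\mathbf{MGrz}$-frame $\mathfrak F=(X,R,E)$ and $x,y,t\in X$. (1) If $x\in\mathbf{smax}_R U$, $y\in\mathbf{max}_R U$ and $x\mathrel Ey$, then $y\in\mathbf{smax}_R U$. (2) If $x\in\mathbf{smax}_R U$, $y\in Q[t]\cap U$ and $x\mathrel Et$, then $x\mathrel Ey$. (3) If $x\in\mathbf{smax}_R U$, $y\in R[t]\cap E[U]$ and $x\mathrel Et$, then $x\mathrel Ey$.
   Context: An $\mathbf{MK}$-frame is $(X,R,E)$, $X\neq\varnothing$, $R\subseteq X^2$, $E$ an equivalence relation, with $x\mathrel Ey$, $y\mathrel Rz$ implying $x\mathrel Ru$, $u\mathrel Ez$ for some $u$. A descriptive $\mathbf{MGrz}$-frame is an $\mathbf{MK}$-frame where $X$ is a Stone space, $R$ and $E$ are continuous (successor sets of points closed; predecessor sets of clopens clopen), and the algebra of clopens with $\Diamond U=R^{ -1}[U]$, $\exists U=E[U]$ validates all theorems of $\mathbf{MGrz}$ (least monadic extension of $\mathbf{Grz}=\mathbf{S4}+\Box(\Box(p\to\Box p)\to p)\to p$ with $\mathbf{S5}$ axioms for $\exists$ and $\exists\Diamond p\to\Diamond\exists p$). $Q=E\circ R$ ($x\mathrel Qy$ iff $x\mathrel Rz$, $z\mathrel Ey$ for some $z$); $R[t]$, $Q[t]$ are the successor sets of $t$; $E[U]$ is the $E$-saturation of $U$. $\mathbf{max}_R U=\{x\in U:\forall y\in U(x\mathrel Ry\Rightarrow y=x)\}$; $\mathbf{smax}_R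 U=\{x\in\mathbf{max}_R U:\forall y\in U(x\mathrel Qy\Rightarrow x\mathrel Ey)\}$. -}

module Defs where

open import Data.Bool using (Bool; true; false; not; _∨_)
open import Data.Nat using (ℕ)
open import Data.Product using (Σ; Σ-syntax; ∃; ∃-syntax; _×_; _,_; proj₁; proj₂)
open import Data.Sum using (_⊎_; inj₁; inj₂)
open import Data.Empty using (⊥; ⊥-elim)
open import Data.Unit using (⊤; tt)
open import Data.List using (List)
open import Data.List.Relation.Unary.Any using (Any)
open import Relation.Binary using (Rel; IsEquivalence)
open import Relation.Binary.PropositionalEquality using (_≡_; refl)
open import Relation.Nullary using (¬_)
open import Function.Bundles using (_⇔_; Equivalence)

record Topology (X : Set) : Set₁ where
  field
    Open      : (X → Set) → Set
    -- openness is a property of the subset (extensional)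
    Open-resp : ∀ {U V : X → Set} → (∀ x → U x → V x) → (∀ x → V x → U x) → Open U → Open V
    Open-univ : Open (λ _ → ⊤)
    Open-∩    : ∀ {U V : X → Set} → Open U → Open V → Open (λ x → U x × V x)
    Open-⋃    : ∀ {I : Set} (F : I → X → Set) → (∀ i → Open (F i)) → Open (λ x → ∃[ i ] F i x)

  Closed : (X → Set) → Set
  Closed U = Open (λ x → ¬ U x)

  -- a clopen set, represented by its (Bool-valued) characteristic function
  IsClopen : (X → Bool) → Set
  IsClopen b = Open (λ x → b x ≡ true) × Open (λ x → b x ≡ false)

  Compact : Set₁
  Compact = ∀ {I : Set} (F : I → X → Set) → (∀ i → Open (F i)) → (∀ x → ∃[ i ] F i x) →
            Σ[ is ∈ List I ] (∀ x → Any (λ i → F i x) is)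

  Hausdorff : Set₁
  Hausdorff = ∀ x y → ¬ (x ≡ y) →
    Σ[ U ∈ (X → Set) ] Σ[ V ∈ (X → Set) ]
      Open U × Open V × U x × V y × (∀ z → U z → V z → ⊥)

  ZeroDimensional : Set₁
  ZeroDimensional = ∀ (W : X → Set) → Open W → ∀ x → W x →
    Σ[ b ∈ (X → Bool) ] IsClopen b × b x ≡ true × (∀ y → b y ≡ true → W y)

  IsStone : Set₁
  IsStone = Compact × Hausdorff × ZeroDimensional

record MKSpace (X : Set) : Set₁ where
  field
    top      : Topology X
  open Topology top public
  field
    stone    : IsStone
    R        : Rel X _
    E        : Rel X _
    E-equiv  : IsEquivalence E
    mk       : ∀ {x y z} → E x y → R y z → ∃[ u ] (R x u × E u z)
    R-succ-closed : ∀ x → Closed (R x)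
    R-pre-clopen  : ∀ (b : X → Bool) → IsClopen b →
      Σ[ c ∈ (X → Bool) ] IsClopen c × (∀ x → (c x ≡ true) ⇔ (∃[ y ] (R x y × b y ≡ true)))
    E-succ-closed : ∀ x → Closed (E x)
    E-pre-clopen  : ∀ (b : X → Bool) → IsClopen b →
      Σ[ c ∈ (X → Bool) ] IsClopen c × (∀ x → (c x ≡ true) ⇔ (∃[ y ] (E x y × b y ≡ true)))

infixr 5 _⇒_
data Fm : Set where
  var  : ℕ → Fm
  ⊥f   : Fm
  _⇒_  : Fm → Fm → Fm
  dia  : Fm → Fm
  ex   : Fm → Fm

neg : Fm → Fm
neg φ = φ ⇒ ⊥f

box : Fm → Fm
box φ = neg (dia (neg φ))

all : Fm → Fm
all φ = neg (ex (neg φ))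

-- Hilbert system: schematic axioms (so closed under substitution), MP, two necessitations
data MGrz⊢_ : Fm → Set where
  ax-K   : ∀ φ ψ → MGrz⊢ (φ ⇒ (ψ ⇒ φ))
  ax-S   : ∀ φ ψ χ → MGrz⊢ ((φ ⇒ (ψ ⇒ χ)) ⇒ ((φ ⇒ ψ) ⇒ (φ ⇒ χ)))
  ax-DN  : ∀ φ → MGrz⊢ (neg (neg φ) ⇒ φ)
  ax-K□  : ∀ φ ψ → MGrz⊢ (box (φ ⇒ ψ) ⇒ (box φ ⇒ box ψ))
  ax-T□  : ∀ φ → MGrz⊢ (box φ ⇒ φ)
  ax-4□  : ∀ φ → MGrz⊢ (box φ ⇒ box (box φ))
  ax-grz : ∀ φ → MGrz⊢ (box (box (φ ⇒ box φ) ⇒ φ) ⇒ φ)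
  ax-K∀  : ∀ φ ψ → MGrz⊢ (all (φ ⇒ ψ) ⇒ (all φ ⇒ all ψ))
  ax-T∀  : ∀ φ → MGrz⊢ (all φ ⇒ φ)
  ax-5∀  : ∀ φ → MGrz⊢ (ex φ ⇒ all (ex φ))
  ax-lc  : ∀ φ → MGrz⊢ (ex (dia φ) ⇒ dia (ex φ))
  mp     : ∀ {φ ψ} → MGrz⊢ (φ ⇒ ψ) → MGrz⊢ φ → MGrz⊢ ψ
  nec□   : ∀ {φ} → MGrz⊢ φ → MGrz⊢ box φ
  nec∀   : ∀ {φ} → MGrz⊢ φ → MGrz⊢ all φ

private
  imp-t→ : ∀ p q → (not p ∨ q) ≡ true → p ≡ false ⊎ q ≡ true
  imp-t→ false q e = inj₁ refl
  imp-t→ true q e = inj₂ e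
  imp-t← : ∀ p q → p ≡ false ⊎ q ≡ true → (not p ∨ q) ≡ true
  imp-t← false q _ = refl
  imp-t← true q (inj₂ e) = e
  imp-f→ : ∀ p q → (not p ∨ q) ≡ false → p ≡ true × q ≡ false
  imp-f→ true false e = refl , refl
  imp-f→ false q ()
  imp-f→ true true ()
  imp-f← : ∀ p q → p ≡ true × q ≡ false → (not p ∨ q) ≡ false
  imp-f← true false _ = refl

module Semantics {X : Set} (S : MKSpace X) where
  open MKSpace S

  Clopen : Set
  Clopen = Σ[ b ∈ (X → Bool) ] IsClopen b

  clopen-⊥ : IsClopen (λ _ → false)
  clopen-⊥ = Open-resp (λ x (i , _) → ⊥-elim i) (λ x ()) (Open-⋃ (λ (_ : ⊥) _ → ⊥) (λ ()))
           , Open-resp (λ x _ → refl) (λ x _ → tt) Open-univ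

  clopen-⇒ : ∀ b c → IsClopen b → IsClopen c → IsClopen (λ x → not (b x) ∨ c x)
  clopen-⇒ b c (bt , bf) (ct , cf) =
      Open-resp (λ x p → imp-t← (b x) (c x) (fromU x p)) (λ x e → toU x (imp-t→ (b x) (c x) e))
                (Open-⋃ F (λ { true → bf ; false → ct }))
    , Open-resp (λ x (p , q) → imp-f← (b x) (c x) (p , q)) (λ x e → imp-f→ (b x) (c x) e)
                (Open-∩ bt cf)
    where
      F : Bool → X → Set
      F true  x = b x ≡ false
      F false x = c x ≡ true
      fromU : ∀ x → ∃[ i ] F i x → b x ≡ false ⊎ c x ≡ true
      fromU x (true , p) = inj₁ p
      fromU x (false , p) = inj₂ p
      toU : ∀ x → b x ≡ false ⊎ c x ≡ true → ∃[ i ] F i x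
      toU x (inj₁ p) = true , p
      toU x (inj₂ p) = false , p

  Valuation : Set
  Valuation = ℕ → Clopen

  ⟦_⟧ : Fm → Valuation → Clopen
  ⟦ var n ⟧ v = v n
  ⟦ ⊥f ⟧ v = (λ _ → false) , clopen-⊥
  ⟦ φ ⇒ ψ ⟧ v with ⟦ φ ⟧ v | ⟦ ψ ⟧ v
  ... | (b , cb) | (c , cc) = (λ x → not (b x) ∨ c x) , clopen-⇒ b c cb cc
  ⟦ dia φ ⟧ v with ⟦ φ ⟧ v
  ... | (b , cb) = proj₁ (R-pre-clopen b cb) , proj₁ (proj₂ (R-pre-clopen b cb))
  ⟦ ex φ ⟧ v with ⟦ φ ⟧ v
  ... | (b , cb) = proj₁ (E-pre-clopen b cb) , proj₁ (proj₂ (E-pre-clopen b cb))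

  Valid : Fm → Set
  Valid φ = ∀ (v : Valuation) (x : X) → proj₁ (⟦ φ ⟧ v) x ≡ true

  ValidatesMGrz : Set
  ValidatesMGrz = ∀ φ → MGrz⊢ φ → Valid φ

record DescMGrzFrame (X : Set) : Set₁ where
  field
    space     : MKSpace X
    validates : Semantics.ValidatesMGrz space
  open MKSpace space public

module FrameNotions {X : Set} (F : DescMGrzFrame X) where
  open DescMGrzFrame F

  Q : X → X → Set
  Q x y = ∃[ z ] (R x z × E z y)

  Esat : (X → Bool) → X → Set
  Esat U y = ∃[ u ] (U u ≡ true × E u y)

  maxR : (X → Bool) → X → Set
  maxR U x = U x ≡ true × (∀ y → U y ≡ true → R x y → y ≡ x)

  smaxR : (X → Bool) → X → Set
  smaxR U x = maxR U x × (∀ y → U y ≡ true → Q x y → E x y)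

module Submission where

open import Defs
open import Data.Bool using (Bool; true)
open import Data.Product using (_×_; _,_)
open import Relation.Binary using (IsEquivalence)
open import Relation.Binary.PropositionalEquality using (_≡_)

module _ {X : Set} (F : DescMGrzFrame X) where
  open DescMGrzFrame F
  open FrameNotions F
  open IsEquivalence E-equiv using () renaming (sym to E-sym; trans to E-trans)

  E-Q-⊆-Q : ∀ {x t y} → E x t → Q t y → Q x y
  E-Q-⊆-Q ext (z , rtz , ezy) with mk ext rtz
  ... | u , rxu , euz = u , rxu , E-trans euz ezy

  smaxR-Q-E : ∀ U {x t y} → smaxR U x → E x t → Q t y → U y ≡ true → E x y
  smaxR-Q-E U (_ , x-smax) ext qty uy = x-smax _ uy (E-Q-⊆-Q ext qty)

  smaxR-R-Esat-E : ∀ U {x t y} → smaxR U x → E x t → R t y → Esat U y → E x y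
  smaxR-R-Esat-E U {y = y} sx ext rty (u , uu , euy) =
    E-trans (smaxR-Q-E U sx ext (y , rty , E-sym euy) uu) euy

  maxR-E-smaxR : ∀ U {x y} → smaxR U x → maxR U y → E x y → smaxR U y
  maxR-E-smaxR U sx my exy =
    my , λ z uz qyz → E-trans (E-sym exy) (smaxR-Q-E U sx exy qyz uz)

lemma7p1 : {X : Set} (F : DescMGrzFrame X) (U : X → Bool) →
    Topology.IsClopen (MKSpace.top (DescMGrzFrame.space F)) U →
    let open DescMGrzFrame F
        open FrameNotions F
    in (∀ x y → smaxR U x → maxR U y → E x y → smaxR U y)
     × (∀ x y t → smaxR U x → Q t y → U y ≡ true → E x t → E x y)
     × (∀ x y t → smaxR U x → R t y → Esat U y → E x t → E x y)
lemma7p1 F U _ =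
    (λ x y sx my exy → maxR-E-smaxR F U sx my exy)
  , (λ x y t sx qty uy ext → smaxR-Q-E F U sx ext qty uy)
  , (λ x y t sx rty ey ext → smaxR-R-Esat-E F U sx ext rty ey)
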